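{- Let $H=(V,E)$ be a finite bipartite graph with no isolated vertices. Let $L$ be the set of leaf vertices (degree $1$) of $H$, $S$ the set of non-leaf vertices adjacent to at least one leaf, and $I$ the set of non-leaf vertices adjacent to no leaf. Suppose $H$ is not a star graph, $H$ is not isomorphic to any of $H_n^1$ ($n\ge2$), $H_n^2$ ($n$ even), $H_n^3$ ($n$ even), $H_n^4$ ($n$ odd, $n\ge3$), and \[\min_{e\in E(H)}|S_1(e)|\ge |E(H)|-\frac{|V(H)|}{2}.\] Then (1) $|V(H)|<2|E(H)|$; (2) $K_{1,1}$ is not a connected component of $H$; (3) $|S|\le 2$.
   Context: For an edge $e$, $S_1(e)$ is the set of edges different from $e$ sharing an endpoint with $e$. A star graph is $K_{1,m}$, $m\ge1$. $H_n^1$ is the disjoint union of $n$ edges; $H_n^2$ and $H_n^3$ ($n$ even) are each, as graphs, the disjoint union of two copies of $K_{1,n/2}$; $H_n^4$ ($n$ odd, $n\ge3$), with $k=\frac{n+1}{2}$, has vertices $u_1,\dots,u_k,v_1,\dots,v_k$ and edges $u_1v_j$ ($1\le j\le k$) and $u_iv_k$ ($1\le i\le k$). -}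

module Defs where

open import Data.Nat using (ℕ; zero; suc; _+_; _*_; _≤_; _<_; _<ᵇ_; _≡ᵇ_)
open import Data.Bool using (Bool; true; false; T; _∧_; _∨_; not)
open import Data.Fin using (Fin; toℕ; fromℕ) renaming (zero to fz)
open import Data.Fin.Properties using () renaming (_≟_ to _≟F_)
open import Data.List using (List; []; _∷_; length; filterᵇ; map; concatMap)
open import Data.Bool.ListAction using (any)
open import Data.List.Membership.Propositional using (_∈_)
open import Data.Product using (Σ; ∃; _×_; _,_; proj₁; proj₂)
open import Data.Sum using (_⊎_)
open import Relation.Binary.PropositionalEquality using (_≡_; _≢_)
open import Relation.Nullary using (¬_)
open import Relation.Nullary.Decidable using (⌊_⌋)
open import Function.Bundles using (_↔_; Inverse)

record Graph : Set where
  field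
    n      : ℕ
    adj    : Fin n → Fin n → Bool
    sym    : ∀ u v → adj u v ≡ adj v u
    irrefl : ∀ u → adj u u ≡ false
open Graph public

vertices : (G : Graph) → List (Fin (n G))
vertices G = Data.List.allFin (n G)

-- E(H): each edge {u,v} listed once, as the ordered pair (u , v) with u < v.
edges : (G : Graph) → List (Fin (n G) × Fin (n G))
edges G = filterᵇ (λ e → adj G (proj₁ e) (proj₂ e) ∧ (toℕ (proj₁ e) <ᵇ toℕ (proj₂ e)))
                  (concatMap (λ i → map (i ,_) (vertices G)) (vertices G))

|V| : Graph → ℕ
|V| G = n G

|E| : Graph → ℕ
|E| G = length (edges G)

_==_ : ∀ {m} → Fin m → Fin m → Bool
a == b = ⌊ a ≟F b ⌋

-- |S₁(e)|: number of edges different from e sharing an endpoint with e.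
|S₁| : (G : Graph) → Fin (n G) × Fin (n G) → ℕ
|S₁| G (a , b) = length (filterᵇ
  (λ { (c , d) → not ((c == a) ∧ (d == b))
                 ∧ ((c == a) ∨ (c == b) ∨ (d == a) ∨ (d == b)) })
  (edges G))

deg : (G : Graph) → Fin (n G) → ℕ
deg G v = length (filterᵇ (adj G v) (vertices G))

isLeaf : (G : Graph) → Fin (n G) → Bool
isLeaf G v = deg G v ≡ᵇ 1

inS : (G : Graph) → Fin (n G) → Bool
inS G v = not (isLeaf G v) ∧ any (λ u → adj G v u ∧ isLeaf G u) (vertices G)

|S| : Graph → ℕ
|S| G = length (filterᵇ (inS G) (vertices G))

Bipartite : Graph → Set
Bipartite G = Σ (Fin (n G) → Bool) λ c → ∀ u v → T (adj G u v) → c u ≢ c v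

NoIsolatedVertices : Graph → Set
NoIsolatedVertices G = ∀ v → ∃ λ u → T (adj G v u)

IsoTo : (G : Graph) (A : Set) → (A → A → Set) → Set
IsoTo G A R = Σ (Fin (n G) ↔ A) λ f →
  ∀ u v → (T (adj G u v) → R (Inverse.to f u) (Inverse.to f v))
        × (R (Inverse.to f u) (Inverse.to f v) → T (adj G u v))

starAdj : ∀ {k} → Fin k → Fin k → Set
starAdj {zero} _ _ = Data.Empty.⊥ where import Data.Empty
starAdj {suc k} i j = (i ≡ fz × j ≢ fz) ⊎ (j ≡ fz × i ≢ fz)

IsStar : Graph → Set
IsStar G = Σ ℕ λ m → 1 ≤ m × IsoTo G (Fin (suc m)) starAdj

-- H_n^1: n disjoint edges; vertices (i , b), edges (i,false)-(i,true).
H1Adj : ∀ {m} → Fin m × Bool → Fin m × Bool → Set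
H1Adj (i , b) (j , c) = i ≡ j × b ≢ c

-- H_n^2 = H_n^3 as graphs (n = 2k): two disjoint copies of K_{1,k}.
H2Adj : ∀ {k} → Bool × Fin (suc k) → Bool × Fin (suc k) → Set
H2Adj (b , i) (c , j) = b ≡ c × starAdj i j

-- H_n^4 (n = 2m+1, k = m+1): u_i = (false , i), v_j = (true , j);
-- edges u_1 v_j for all j and u_i v_k for all i.
H4Adj : ∀ {m} → Bool × Fin (suc m) → Bool × Fin (suc m) → Set
H4Adj {m} (b , i) (c , j) =
    (b ≡ false × c ≡ true × (i ≡ fz ⊎ j ≡ fromℕ m))
  ⊎ (b ≡ true × c ≡ false × (j ≡ fz ⊎ i ≡ fromℕ m))

IsExceptional : Graph → Set
IsExceptional G =
    (Σ ℕ λ n₁ → 2 ≤ n₁ × IsoTo G (Fin n₁ × Bool) H1Adj)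
  ⊎ (Σ ℕ λ k → 1 ≤ k × IsoTo G (Bool × Fin (suc k)) H2Adj)
  ⊎ (Σ ℕ λ k → 1 ≤ k × IsoTo G (Bool × Fin (suc k)) H2Adj)
  ⊎ (Σ ℕ λ m → 1 ≤ m × IsoTo G (Bool × Fin (suc m)) H4Adj)

-- K_{1,1} is a connected component: an edge both of whose endpoints are leaves.
HasK11Component : Graph → Set
HasK11Component G = ∃ λ u → ∃ λ v → T (adj G u v) × deg G u ≡ 1 × deg G v ≡ 1

-- Let X = Σ_v (deg v − 1), so that 2|E| = |V| + X by the handshake lemma (no vertex is isolated).
-- If X = 0 every vertex is a leaf, so H is a perfect matching, i.e. K_{1,1} or some H_n^1, both
-- excluded; hence X > 0, which is (1). For an edge ab one has |S₁(ab)| ≤ deg a + deg b − 2, so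
-- the hypothesis gives X ≤ 2 ((deg a − 1) + (deg b − 1)) for every edge ab. An edge joining two
-- leaves would force X = 0, which gives (2). Every s ∈ S has a leaf neighbour, so X ≤ 2 (deg s − 1);
-- summing over S gives |S| X ≤ 2 X, which gives (3).
module Submission where

open import Data.Bool using (Bool; true; false; T; _∧_; _∨_; not)
open import Data.Bool.Properties using (∧-zeroʳ; ∧-identityʳ; T-∧; ¬-not)
open import Data.Empty using (⊥-elim)
open import Data.Fin using (Fin; zero; suc; toℕ; fromℕ<)
open import Data.Fin.Properties using (toℕ-injective; suc-injective) renaming (_≟_ to _≟ᶠ_)
open import Data.List
  using (List; []; _∷_; _++_; length; filterᵇ; map; concatMap; tabulate; allFin; cartesianProduct; lookup)
open import Data.List.Membership.Propositional using (_∈_)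
open import Data.List.Membership.Propositional.Properties
  using (∈-filter⁺; ∈-filter⁻; ∈-cartesianProduct⁺; ∈-allFin; ∈-lookup)
open import Data.List.Properties using (filter-++; length-++; map-tabulate)
import Data.List.Relation.Unary.All as All
open import Data.List.Relation.Unary.AllPairs using (_∷_)
open import Data.List.Relation.Unary.Any using (index; satisfied)
open import Data.List.Relation.Unary.Any.Properties using (lookup-index; any⁻)
open import Data.List.Relation.Unary.Unique.Propositional using (Unique)
import Data.List.Relation.Unary.Unique.Propositional.Properties as Unique
open import Data.Nat using (ℕ; zero; suc; _+_; _*_; _∸_; _≤_; _<_; _<ᵇ_; z≤n; s≤s; >-nonZero)
open import Data.Nat.Properties
  using (≤-refl; ≤-reflexive; ≤-trans; ≤-antisym; <-asym; ≮⇒≥; <⇒≱; n≤0⇒n≡0; n≢0⇒n>0;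
         +-comm; +-identityʳ; *-identityˡ; m≤m+n; m≤n+m; m+[n∸m]≡n;
         +-mono-≤; +-monoˡ-≤; +-monoʳ-≤; *-monoʳ-≤; +-cancelˡ-≤; +-cancelʳ-≤; *-cancelʳ-≤;
         <ᵇ-reflects-<; <ᵇ⇒<; ≡ᵇ⇒≡; +-*-semiring; module ≤-Reasoning)
open import Algebra.Properties.Semiring.Sum +-*-semiring
  using (sum-syntax; sum-cong-≗; sum-replicate-zero; ∑-distrib-+; ∑-comm; *-distribˡ-sum; *-distribʳ-sum)
open import Data.Nat.Tactic.RingSolver using (solve-∀)
open import Data.Product using (∃; _×_; _,_; proj₁; proj₂)
open import Data.Sum using (_⊎_; inj₁; inj₂; [_,_]′)
open import Data.Unit using (tt)
open import Function using (_∘_)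
open import Function.Bundles using (Equivalence; Inverse; _↔_; mk↔ₛ′)
open import Function.Construct.Composition using (_↔-∘_)
open import Relation.Binary.PropositionalEquality
  using (_≡_; _≢_; refl; cong; cong₂; sym; trans; subst; subst₂; module ≡-Reasoning)
open import Relation.Nullary using (¬_; yes; no)
open import Relation.Nullary.Decidable using (T?; toWitness; dec-true; dec-false; isYes≗does)
open import Relation.Nullary.Reflects using (ofʸ; ofⁿ)

open import Defs hiding (sym)

𝟙 : Bool → ℕ
𝟙 true  = 1
𝟙 false = 0

𝟙-T : ∀ {b} → T b → 𝟙 b ≡ 1
𝟙-T {true} _ = refl

∑-mono-≤ : ∀ {n} {f g : Fin n → ℕ} → (∀ i → f i ≤ g i) → ∑[ i < n ] f i ≤ ∑[ i < n ] g i
∑-mono-≤ {zero}  f≤g = z≤n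
∑-mono-≤ {suc n} f≤g = +-mono-≤ (f≤g zero) (∑-mono-≤ (f≤g ∘ suc))

∑-one : ∀ n → ∑[ i < n ] 1 ≡ n
∑-one zero    = refl
∑-one (suc n) = cong suc (∑-one n)

term≤∑ : ∀ {n} (f : Fin n → ℕ) i → f i ≤ ∑[ j < n ] f j
term≤∑ f zero    = m≤m+n _ _
term≤∑ f (suc i) = ≤-trans (term≤∑ (f ∘ suc) i) (m≤n+m _ _)

two-terms≤∑ : ∀ {n} (f : Fin n → ℕ) {i j} → i ≢ j → f i + f j ≤ ∑[ k < n ] f k
two-terms≤∑ f {zero}  {zero}  0≢0 = ⊥-elim (0≢0 refl)
two-terms≤∑ f {zero}  {suc j} _   = +-mono-≤ ≤-refl (term≤∑ (f ∘ suc) j)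
two-terms≤∑ f {suc i} {zero}  _   =
  ≤-trans (≤-reflexive (+-comm (f (suc i)) (f zero))) (+-mono-≤ ≤-refl (term≤∑ (f ∘ suc) i))
two-terms≤∑ f {suc i} {suc j} i≢j = ≤-trans (two-terms≤∑ (f ∘ suc) (i≢j ∘ cong suc)) (m≤n+m _ _)

∑-select : ∀ {n} (f : Fin n → ℕ) a → (∀ i → i ≢ a → f i ≡ 0) → ∑[ i < n ] f i ≡ f a
∑-select {suc n} f zero    f≡0 =
  trans (cong (f zero +_) (trans (sum-cong-≗ (λ i → f≡0 (suc i) λ ())) (sum-replicate-zero n)))
        (+-identityʳ (f zero))
∑-select         f (suc a) f≡0 =
  cong₂ _+_ (f≡0 zero λ ()) (∑-select (f ∘ suc) a (λ i i≢a → f≡0 (suc i) (i≢a ∘ suc-injective)))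

∑∑-distrib-+ : ∀ {m n} (f g : Fin m → Fin n → ℕ) →
  ∑[ i < m ] ∑[ j < n ] (f i j + g i j) ≡ ∑[ i < m ] ∑[ j < n ] f i j + ∑[ i < m ] ∑[ j < n ] g i j
∑∑-distrib-+ {n = n} f g = trans (sum-cong-≗ (λ i → ∑-distrib-+ (f i) (g i)))
                                 (∑-distrib-+ (λ i → ∑[ j < n ] f i j) (λ i → ∑[ j < n ] g i j))

count*≤∑ : ∀ {n} (p : Fin n → Bool) (f : Fin n → ℕ) c → (∀ i → T (p i) → c ≤ f i) →
  (∑[ i < n ] 𝟙 (p i)) * c ≤ ∑[ i < n ] f i
count*≤∑ p f c c≤f = ≤-trans (≤-reflexive (*-distribʳ-sum c (𝟙 ∘ p))) (∑-mono-≤ term)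
  where
  term : ∀ i → 𝟙 (p i) * c ≤ f i
  term i with p i | c≤f i
  ... | true  | c≤fi = subst (_≤ f i) (sym (*-identityˡ c)) (c≤fi tt)
  ... | false | _    = z≤n

module _ {n : ℕ} where

  ==-refl : (a : Fin n) → (a == a) ≡ true
  ==-refl a = trans (isYes≗does (a ≟ᶠ a)) (dec-true (a ≟ᶠ a) refl)

  ==-≢ : {a b : Fin n} → a ≢ b → (a == b) ≡ false
  ==-≢ {a} {b} a≢b = trans (isYes≗does (a ≟ᶠ b)) (dec-false (a ≟ᶠ b) a≢b)

  ∑-𝟙-∧-== : (g : Fin n → Bool) (a : Fin n) → ∑[ i < n ] 𝟙 (g i ∧ (i == a)) ≡ 𝟙 (g a)
  ∑-𝟙-∧-== g a = begin
    ∑[ i < n ] 𝟙 (g i ∧ (i == a)) ≡⟨ ∑-select _ a vanishes ⟩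
    𝟙 (g a ∧ (a == a))            ≡⟨ cong (λ b → 𝟙 (g a ∧ b)) (==-refl a) ⟩
    𝟙 (g a ∧ true)                ≡⟨ cong 𝟙 (∧-identityʳ (g a)) ⟩
    𝟙 (g a)                       ∎
    where
    open ≡-Reasoning
    vanishes : ∀ i → i ≢ a → 𝟙 (g i ∧ (i == a)) ≡ 0
    vanishes i i≢a = trans (cong (λ b → 𝟙 (g i ∧ b)) (==-≢ i≢a)) (cong 𝟙 (∧-zeroʳ (g i)))

  ∑∑-𝟙-== : (a b : Fin n) → ∑[ i < n ] ∑[ j < n ] 𝟙 ((i == a) ∧ (j == b)) ≡ 1
  ∑∑-𝟙-== a b =
    trans (sum-cong-≗ (λ i → ∑-𝟙-∧-== (λ _ → i == a) b)) (∑-𝟙-∧-== (λ _ → true) a)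

𝟙-<ᵇ-exclusive : ∀ {m n} → m ≢ n → 𝟙 (m <ᵇ n) + 𝟙 (n <ᵇ m) ≡ 1
𝟙-<ᵇ-exclusive {m} {n} m≢n with m <ᵇ n | <ᵇ-reflects-< m n | n <ᵇ m | <ᵇ-reflects-< n m
... | true  | ofʸ m<n | true  | ofʸ n<m = ⊥-elim (<-asym m<n n<m)
... | true  | _       | false | _       = refl
... | false | _       | true  | _       = refl
... | false | ofⁿ m≮n | false | ofⁿ n≮m = ⊥-elim (m≢n (≤-antisym (≮⇒≥ n≮m) (≮⇒≥ m≮n)))

module _ {A : Set} where

  length-filterᵇ-tabulate : ∀ {n} (p : A → Bool) (f : Fin n → A) →
    length (filterᵇ p (tabulate f)) ≡ ∑[ i < n ] 𝟙 (p (f i))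
  length-filterᵇ-tabulate {zero}  p f = refl
  length-filterᵇ-tabulate {suc n} p f with p (f zero)
  ... | true  = cong suc (length-filterᵇ-tabulate p (f ∘ suc))
  ... | false = length-filterᵇ-tabulate p (f ∘ suc)

  length-filterᵇ-filterᵇ : (p q : A → Bool) (xs : List A) →
    length (filterᵇ q (filterᵇ p xs)) ≡ length (filterᵇ (λ x → p x ∧ q x) xs)
  length-filterᵇ-filterᵇ p q [] = refl
  length-filterᵇ-filterᵇ p q (x ∷ xs) with p x
  ... | false = length-filterᵇ-filterᵇ p q xs
  ... | true with q x
  ...   | true  = cong suc (length-filterᵇ-filterᵇ p q xs)
  ...   | false = length-filterᵇ-filterᵇ p q xs

  length-filterᵇ-++ : (p : A → Bool) (xs ys : List A) →
    length (filterᵇ p (xs ++ ys)) ≡ length (filterᵇ p xs) + length (filterᵇ p ys)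
  length-filterᵇ-++ p xs ys = trans (cong length (filter-++ (T? ∘ p) xs ys)) (length-++ (filterᵇ p xs))

  lookup-injective : ∀ {xs : List A} → Unique xs → ∀ i j → lookup xs i ≡ lookup xs j → i ≡ j
  lookup-injective (_  ∷ _) zero    zero    _  = refl
  lookup-injective (x≢ ∷ _) zero    (suc j) eq = ⊥-elim (All.lookup x≢ (∈-lookup j) eq)
  lookup-injective (x≢ ∷ _) (suc i) zero    eq = ⊥-elim (All.lookup x≢ (∈-lookup i) (sym eq))
  lookup-injective (_  ∷ u) (suc i) (suc j) eq = cong suc (lookup-injective u i j eq)

  index-unique : ∀ {xs : List A} {x i} → Unique xs → (x∈xs : x ∈ xs) →
    x ≡ lookup xs i → index x∈xs ≡ i
  index-unique u x∈xs x≡ = lookup-injective u _ _ (trans (sym (lookup-index x∈xs)) x≡)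

length-filterᵇ-allFin : ∀ {n} (p : Fin n → Bool) → length (filterᵇ p (allFin n)) ≡ ∑[ i < n ] 𝟙 (p i)
length-filterᵇ-allFin p = length-filterᵇ-tabulate p (λ i → i)

pairs≡cartesianProduct : ∀ {A B : Set} (xs : List A) (ys : List B) →
  concatMap (λ x → map (x ,_) ys) xs ≡ cartesianProduct xs ys
pairs≡cartesianProduct []       ys = refl
pairs≡cartesianProduct (x ∷ xs) ys = cong (map (x ,_) ys ++_) (pairs≡cartesianProduct xs ys)

length-filterᵇ-pairs : ∀ {m n} (p : Fin m × Fin n → Bool) →
  length (filterᵇ p (concatMap (λ i → map (i ,_) (allFin n)) (allFin m)))
    ≡ ∑[ i < m ] ∑[ j < n ] 𝟙 (p (i , j))
length-filterᵇ-pairs {m} {n} p = rows-count (λ i → i)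
  where
  row : Fin m → List (Fin m × Fin n)
  row i = map (i ,_) (allFin n)

  rows-count : ∀ {k} (f : Fin k → Fin m) →
    length (filterᵇ p (concatMap row (tabulate f))) ≡ ∑[ i < k ] ∑[ j < n ] 𝟙 (p (f i , j))
  rows-count {zero}  f = refl
  rows-count {suc k} f = begin
    length (filterᵇ p (row (f zero) ++ concatMap row (tabulate (f ∘ suc))))
      ≡⟨ length-filterᵇ-++ p (row (f zero)) _ ⟩
    length (filterᵇ p (row (f zero))) + length (filterᵇ p (concatMap row (tabulate (f ∘ suc))))
      ≡⟨ cong₂ _+_ (trans (cong (length ∘ filterᵇ p) (map-tabulate (λ j → j) (f zero ,_)))
                          (length-filterᵇ-tabulate p (f zero ,_)))
                   (rows-count (f ∘ suc)) ⟩
    ∑[ j < n ] 𝟙 (p (f zero , j)) + ∑[ i < k ] ∑[ j < n ] 𝟙 (p (f (suc i) , j)) ∎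
    where open ≡-Reasoning

-- Degrees, edges and |S₁|

module _ (G : Graph) where

  isEdge : Fin (n G) → Fin (n G) → Bool
  isEdge i j = adj G i j ∧ (toℕ i <ᵇ toℕ j)

  private
    isEdgeᵖ : Fin (n G) × Fin (n G) → Bool
    isEdgeᵖ e = isEdge (proj₁ e) (proj₂ e)

    vertexPairs : List (Fin (n G) × Fin (n G))
    vertexPairs = concatMap (λ i → map (i ,_) (vertices G)) (vertices G)

    vertexPairs≡ : vertexPairs ≡ cartesianProduct (vertices G) (vertices G)
    vertexPairs≡ = pairs≡cartesianProduct (vertices G) (vertices G)

  adj-sym : ∀ {u v} → T (adj G u v) → T (adj G v u)
  adj-sym {u} {v} = subst T (Graph.sym G u v)

  adj⇒≢ : ∀ {u v} → T (adj G u v) → u ≢ v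
  adj⇒≢ {u} uv refl = subst T (irrefl G u) uv

  𝟙-adj-split : ∀ v j → 𝟙 (adj G v j) ≡ 𝟙 (isEdge v j) + 𝟙 (isEdge j v)
  𝟙-adj-split v j rewrite Graph.sym G j v with adj G v j in vj
  ... | false = refl
  ... | true  = sym (𝟙-<ᵇ-exclusive (λ eq → adj⇒≢ (subst T (sym vj) tt) (toℕ-injective eq)))

  adj⇒isEdge : ∀ {u v} → T (adj G u v) → T (isEdge u v) ⊎ T (isEdge v u)
  adj⇒isEdge {u} {v} uv with isEdge u v | isEdge v u | 𝟙-adj-split u v
  ... | true  | _     | _     = inj₁ tt
  ... | false | true  | _     = inj₂ tt
  ... | false | false | uv≡0 with () ← trans (sym (𝟙-T uv)) uv≡0

  isEdge⇒< : ∀ {x y} → T (isEdge x y) → toℕ x < toℕ y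
  isEdge⇒< {x} {y} xy = <ᵇ⇒< (toℕ x) (toℕ y) (proj₂ (Equivalence.to T-∧ xy))

  ∈-edges⁺ : ∀ {a b} → T (isEdge a b) → (a , b) ∈ edges G
  ∈-edges⁺ {a} {b} ab = ∈-filter⁺ (T? ∘ isEdgeᵖ)
    (subst ((a , b) ∈_) (sym vertexPairs≡) (∈-cartesianProduct⁺ (∈-allFin a) (∈-allFin b))) ab

  ∈-edges⁻ : ∀ {e} → e ∈ edges G → T (isEdge (proj₁ e) (proj₂ e))
  ∈-edges⁻ e∈ = proj₂ (∈-filter⁻ (T? ∘ isEdgeᵖ) {xs = vertexPairs} e∈)

  edges-unique : Unique (edges G)
  edges-unique = Unique.filter⁺ (T? ∘ isEdgeᵖ)
    (subst Unique (sym vertexPairs≡) (Unique.cartesianProduct⁺ (Unique.allFin⁺ (n G)) (Unique.allFin⁺ (n G))))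

  deg≡∑ : ∀ v → deg G v ≡ ∑[ j < n G ] 𝟙 (adj G v j)
  deg≡∑ v = length-filterᵇ-allFin (adj G v)

  adj⇒1≤deg : ∀ {v u} → T (adj G v u) → 1 ≤ deg G v
  adj⇒1≤deg {v} {u} vu = subst₂ _≤_ (𝟙-T vu) (sym (deg≡∑ v)) (term≤∑ (𝟙 ∘ adj G v) u)

  leaf-neighbour-unique : ∀ {v x y} → deg G v ≡ 1 → T (adj G v x) → T (adj G v y) → x ≡ y
  leaf-neighbour-unique {v} {x} {y} deg≡1 vx vy with x ≟ᶠ y
  ... | yes x≡y = x≡y
  ... | no  x≢y with s≤s () ← subst₂ _≤_ (cong₂ _+_ (𝟙-T vx) (𝟙-T vy)) (trans (sym (deg≡∑ v)) deg≡1)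
                                          (two-terms≤∑ (𝟙 ∘ adj G v) x≢y)

  inS⇒leaf-neighbour : ∀ {s} → T (inS G s) → ∃ λ l → T (adj G s l) × deg G l ≡ 1
  inS⇒leaf-neighbour s∈S
    with l , sl∧leaf ← satisfied (any⁻ _ (vertices G) (proj₂ (Equivalence.to T-∧ s∈S)))
    with sl , leaf ← Equivalence.to T-∧ sl∧leaf
    = l , sl , ≡ᵇ⇒≡ (deg G l) 1 leaf

  |E|≡∑∑ : |E| G ≡ ∑[ i < n G ] ∑[ j < n G ] 𝟙 (isEdge i j)
  |E|≡∑∑ = length-filterᵇ-pairs isEdgeᵖ

  deg≡out+in : ∀ v → deg G v ≡ ∑[ j < n G ] 𝟙 (isEdge v j) + ∑[ i < n G ] 𝟙 (isEdge i v)
  deg≡out+in v = trans (deg≡∑ v)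
    (trans (sum-cong-≗ (𝟙-adj-split v)) (∑-distrib-+ (λ j → 𝟙 (isEdge v j)) (λ j → 𝟙 (isEdge j v))))

  handshake : ∑[ v < n G ] deg G v ≡ 2 * |E| G
  handshake = begin
    ∑[ v < n G ] deg G v
      ≡⟨ trans (sum-cong-≗ deg≡out+in) (∑-distrib-+ out in′) ⟩
    ∑[ v < n G ] out v + ∑[ v < n G ] in′ v
      ≡⟨ cong (∑[ v < n G ] out v +_) (∑-comm (λ v i → 𝟙 (isEdge i v))) ⟩
    ∑[ v < n G ] out v + ∑[ v < n G ] out v
      ≡⟨ cong (λ m → m + m) (sym |E|≡∑∑) ⟩
    |E| G + |E| G
      ≡⟨ cong (|E| G +_) (sym (+-identityʳ (|E| G))) ⟩
    2 * |E| G ∎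
    where
    open ≡-Reasoning
    out in′ : Fin (n G) → ℕ
    out v = ∑[ j < n G ] 𝟙 (isEdge v j)
    in′ v = ∑[ i < n G ] 𝟙 (isEdge i v)

  deg≡∑∑ : ∀ v →
    deg G v ≡ ∑[ i < n G ] ∑[ j < n G ] (𝟙 (isEdge i j ∧ (i == v)) + 𝟙 (isEdge i j ∧ (j == v)))
  deg≡∑∑ v = begin
    deg G v
      ≡⟨ deg≡out+in v ⟩
    ∑[ j < n G ] 𝟙 (isEdge v j) + ∑[ i < n G ] 𝟙 (isEdge i v)
      ≡⟨ cong₂ _+_ (trans (sum-cong-≗ (λ j → sym (∑-𝟙-∧-== (λ i → isEdge i j) v)))
                          (∑-comm (λ j i → at-i i j)))
                   (sum-cong-≗ (λ i → sym (∑-𝟙-∧-== (isEdge i) v))) ⟩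
    ∑[ i < n G ] ∑[ j < n G ] at-i i j + ∑[ i < n G ] ∑[ j < n G ] at-j i j
      ≡⟨ sym (∑∑-distrib-+ at-i at-j) ⟩
    ∑[ i < n G ] ∑[ j < n G ] (at-i i j + at-j i j) ∎
    where
    open ≡-Reasoning
    at-i at-j : Fin (n G) → Fin (n G) → ℕ
    at-i i j = 𝟙 (isEdge i j ∧ (i == v))
    at-j i j = 𝟙 (isEdge i j ∧ (j == v))

  shares : Fin (n G) → Fin (n G) → Fin (n G) → Fin (n G) → Bool
  shares a b i j = not ((i == a) ∧ (j == b)) ∧ ((i == a) ∨ (i == b) ∨ (j == a) ∨ (j == b))

  |S₁|≡∑∑ : ∀ a b → |S₁| G (a , b) ≡ ∑[ i < n G ] ∑[ j < n G ] 𝟙 (isEdge i j ∧ shares a b i j)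
  |S₁|≡∑∑ a b = trans (length-filterᵇ-filterᵇ isEdgeᵖ _ vertexPairs)
                      (length-filterᵇ-pairs (λ e → isEdgeᵖ e ∧ shares a b (proj₁ e) (proj₂ e)))

  |S₁|+2≤deg+deg : ∀ {a b} → T (isEdge a b) → |S₁| G (a , b) + 2 ≤ deg G a + deg G b
  |S₁|+2≤deg+deg {a} {b} ab = begin
    |S₁| G (a , b) + 2
      ≡⟨ cong₂ _+_ (|S₁|≡∑∑ a b) (sym (cong₂ _+_ (∑∑-𝟙-== a b) (∑∑-𝟙-== a b))) ⟩
    ∑∑ S + (∑∑ P + ∑∑ P)
      ≡⟨ sym (trans (∑∑-distrib-+ S (λ i j → P i j + P i j)) (cong (∑∑ S +_) (∑∑-distrib-+ P P))) ⟩
    ∑∑ (λ i j → S i j + (P i j + P i j))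
      ≤⟨ ∑-mono-≤ (λ i → ∑-mono-≤ (λ j →
           pointwise (isEdge i j) (i == a) (j == b) (i == b) (j == a) (only-ab i j))) ⟩
    ∑∑ (λ i j → D a i j + D b i j)
      ≡⟨ ∑∑-distrib-+ (D a) (D b) ⟩
    ∑∑ (D a) + ∑∑ (D b)
      ≡⟨ sym (cong₂ _+_ (deg≡∑∑ a) (deg≡∑∑ b)) ⟩
    deg G a + deg G b ∎
    where
    open ≤-Reasoning
    ∑∑ : (Fin (n G) → Fin (n G) → ℕ) → ℕ
    ∑∑ f = ∑[ i < n G ] ∑[ j < n G ] f i j
    S P : Fin (n G) → Fin (n G) → ℕ
    S i j = 𝟙 (isEdge i j ∧ shares a b i j)
    P i j = 𝟙 ((i == a) ∧ (j == b))
    D : Fin (n G) → Fin (n G) → Fin (n G) → ℕ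
    D v i j = 𝟙 (isEdge i j ∧ (i == v)) + 𝟙 (isEdge i j ∧ (j == v))

    only-ab : ∀ i j → T ((i == a) ∧ (j == b)) → T (isEdge i j)
    only-ab i j i=a∧j=b with i=a , j=b ← Equivalence.to T-∧ i=a∧j=b
      rewrite toWitness {a? = i ≟ᶠ a} i=a | toWitness {a? = j ≟ᶠ b} j=b = ab

    -- e = [ij is an edge], x = [i = a], y = [j = b], z = [i = b], w = [j = a]
    pointwise : ∀ e x y z w → (T (x ∧ y) → T e) →
      𝟙 (e ∧ (not (x ∧ y) ∧ (x ∨ z ∨ w ∨ y))) + (𝟙 (x ∧ y) + 𝟙 (x ∧ y))
        ≤ (𝟙 (e ∧ x) + 𝟙 (e ∧ w)) + (𝟙 (e ∧ z) + 𝟙 (e ∧ y))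
    pointwise false false _     _     _     _    = z≤n
    pointwise false true  false _     _     _    = z≤n
    pointwise false true  true  _     _     xy⇒e = ⊥-elim (xy⇒e tt)
    pointwise true  true  true  z     w     _    = s≤s (≤-trans (m≤n+m 1 (𝟙 z)) (m≤n+m _ (𝟙 w)))
    pointwise true  true  false _     _     _    = s≤s z≤n
    pointwise true  false _     true  _     _    = ≤-trans (s≤s z≤n) (m≤n+m _ _)
    pointwise true  false _     false true  _    = s≤s z≤n
    pointwise true  false y     false false _    = ≤-reflexive (+-identityʳ (𝟙 y))

  -- 1-regular graphs are perfect matchings

  endpoint : Bool → Fin (n G) × Fin (n G) → Fin (n G)
  endpoint false = proj₁
  endpoint true  = proj₂

  endpoints-adjacent : ∀ {e} → e ∈ edges G → ∀ b → T (adj G (endpoint b e) (endpoint (not b) e))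
  endpoints-adjacent e∈ false = proj₁ (Equivalence.to T-∧ (∈-edges⁻ e∈))
  endpoints-adjacent e∈ true  = adj-sym (endpoints-adjacent e∈ false)

  record IncidentEdge (v : Fin (n G)) : Set where
    field
      side    : Bool
      edge    : Fin (n G) × Fin (n G)
      edge∈   : edge ∈ edges G
      at-side : endpoint side edge ≡ v

  incidentEdge : NoIsolatedVertices G → ∀ v → IncidentEdge v
  incidentEdge ni v with adj⇒isEdge (proj₂ (ni v))
  ... | inj₁ vu = record { side = false ; edge = _ ; edge∈ = ∈-edges⁺ vu ; at-side = refl }
  ... | inj₂ uv = record { side = true  ; edge = _ ; edge∈ = ∈-edges⁺ uv ; at-side = refl }

  module _ (deg≡1 : ∀ v → deg G v ≡ 1) where

    same-endpoint⇒same-edge : ∀ {b b′ e e′} → e ∈ edges G → e′ ∈ edges G →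
      endpoint b e ≡ endpoint b′ e′ → b ≡ b′ × e ≡ e′
    same-endpoint⇒same-edge {b} {b′} {x , y} {x′ , y′} e∈ e′∈ same =
      compare b b′ same (leaf-neighbour-unique (deg≡1 _) (endpoints-adjacent e∈ b)
                           (subst (λ u → T (adj G u _)) (sym same) (endpoints-adjacent e′∈ b′)))
      where
      compare : ∀ b b′ → endpoint b (x , y) ≡ endpoint b′ (x′ , y′) →
        endpoint (not b) (x , y) ≡ endpoint (not b′) (x′ , y′) → b ≡ b′ × (x , y) ≡ (x′ , y′)
      compare false false refl refl = refl , refl
      compare true  true  refl refl = refl , refl
      compare false true  refl refl = ⊥-elim (<-asym (isEdge⇒< (∈-edges⁻ e∈)) (isEdge⇒< (∈-edges⁻ e′∈)))
      compare true  false refl refl = ⊥-elim (<-asym (isEdge⇒< (∈-edges⁻ e∈)) (isEdge⇒< (∈-edges⁻ e′∈)))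

    perfect-matching : NoIsolatedVertices G → IsoTo G (Fin (|E| G) × Bool) H1Adj
    perfect-matching ni = mk↔ₛ′ toPair fromPair to-from from-to , λ u v → adj⇒H1Adj u v , H1Adj⇒adj u v
      where
      open IncidentEdge

      toPair : Fin (n G) → Fin (|E| G) × Bool
      toPair v = index (edge∈ (incidentEdge ni v)) , side (incidentEdge ni v)

      fromPair : Fin (|E| G) × Bool → Fin (n G)
      fromPair (i , b) = endpoint b (lookup (edges G) i)

      from-to : ∀ v → fromPair (toPair v) ≡ v
      from-to v = trans (cong (endpoint (side I)) (sym (lookup-index (edge∈ I)))) (at-side I)
        where
        I : IncidentEdge v
        I = incidentEdge ni v

      to-from : ∀ p → toPair (fromPair p) ≡ p
      to-from (i , b) = cong₂ _,_ (index-unique edges-unique (edge∈ I) (proj₂ same)) (proj₁ same)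
        where
        I : IncidentEdge (fromPair (i , b))
        I = incidentEdge ni (fromPair (i , b))
        same : side I ≡ b × edge I ≡ lookup (edges G) i
        same = same-endpoint⇒same-edge (edge∈ I) (∈-lookup i) (at-side I)

      fromPair-adj⇒H1Adj : ∀ p q → T (adj G (fromPair p) (fromPair q)) → H1Adj p q
      fromPair-adj⇒H1Adj (i , b) (j , c) uv
        with not-b≡c , eᵢ≡eⱼ ← same-endpoint⇒same-edge (∈-lookup i) (∈-lookup j)
               (leaf-neighbour-unique (deg≡1 _) (endpoints-adjacent (∈-lookup i) b) uv)
        = lookup-injective edges-unique i j eᵢ≡eⱼ , not≡⇒≢ not-b≡c
        where
        not≡⇒≢ : ∀ {b c} → not b ≡ c → b ≢ c
        not≡⇒≢ {false} refl ()
        not≡⇒≢ {true}  refl ()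

      H1Adj⇒fromPair-adj : ∀ p q → H1Adj p q → T (adj G (fromPair p) (fromPair q))
      H1Adj⇒fromPair-adj (i , b) (.i , c) (refl , b≢c) rewrite ¬-not b≢c =
        adj-sym (endpoints-adjacent (∈-lookup i) c)

      adj⇒H1Adj : ∀ u v → T (adj G u v) → H1Adj (toPair u) (toPair v)
      adj⇒H1Adj u v uv = fromPair-adj⇒H1Adj (toPair u) (toPair v)
        (subst₂ (λ x y → T (adj G x y)) (sym (from-to u)) (sym (from-to v)) uv)

      H1Adj⇒adj : ∀ u v → H1Adj (toPair u) (toPair v) → T (adj G u v)
      H1Adj⇒adj u v h = subst₂ (λ x y → T (adj G x y)) (from-to u) (from-to v)
        (H1Adj⇒fromPair-adj (toPair u) (toPair v) h)

IsoTo-trans : ∀ {G A B R S} → IsoTo G A R → (φ : A ↔ B) →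
  (∀ x y → R x y → S (Inverse.to φ x) (Inverse.to φ y)) →
  (∀ x y → S (Inverse.to φ x) (Inverse.to φ y) → R x y) → IsoTo G B S
IsoTo-trans (f , f-adj) φ R⇒S S⇒R =
  φ ↔-∘ f , λ u v → R⇒S _ _ ∘ proj₁ (f-adj u v) , proj₂ (f-adj u v) ∘ S⇒R _ _

private
  to : Fin 1 × Bool → Fin 2
  to (_ , false) = zero
  to (_ , true)  = suc zero

  from : Fin 2 → Fin 1 × Bool
  from zero       = zero , false
  from (suc zero) = zero , true

edge↔K₁,₁ : (Fin 1 × Bool) ↔ Fin 2
edge↔K₁,₁ = mk↔ₛ′ to from (λ { zero → refl ; (suc zero) → refl })
                            (λ { (zero , false) → refl ; (zero , true) → refl })

H1Adj⇒starAdj : ∀ x y → H1Adj x y → starAdj (Inverse.to edge↔K₁,₁ x) (Inverse.to edge↔K₁,₁ y)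
H1Adj⇒starAdj (zero , false) (zero , false) (_ , f≢f) = ⊥-elim (f≢f refl)
H1Adj⇒starAdj (zero , false) (zero , true)  _         = inj₁ (refl , λ ())
H1Adj⇒starAdj (zero , true)  (zero , false) _         = inj₂ (refl , λ ())
H1Adj⇒starAdj (zero , true)  (zero , true)  (_ , t≢t) = ⊥-elim (t≢t refl)

starAdj⇒H1Adj : ∀ x y → starAdj (Inverse.to edge↔K₁,₁ x) (Inverse.to edge↔K₁,₁ y) → H1Adj x y
starAdj⇒H1Adj (zero , false) (zero , false) (inj₁ (_ , 0≢0)) = ⊥-elim (0≢0 refl)
starAdj⇒H1Adj (zero , false) (zero , false) (inj₂ (_ , 0≢0)) = ⊥-elim (0≢0 refl)
starAdj⇒H1Adj (zero , false) (zero , true)  _                = refl , λ ()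
starAdj⇒H1Adj (zero , true)  (zero , false) _                = refl , λ ()
starAdj⇒H1Adj (zero , true)  (zero , true)  (inj₁ (() , _))
starAdj⇒H1Adj (zero , true)  (zero , true)  (inj₂ (() , _))

1-regular⇒star-or-exceptional : ∀ G → 1 ≤ n G → NoIsolatedVertices G → (∀ v → deg G v ≡ 1) →
  IsStar G ⊎ IsExceptional G
1-regular⇒star-or-exceptional G 1≤n ni deg≡1 = by-size (|E| G) (perfect-matching G deg≡1 ni)
  where
  by-size : ∀ m → IsoTo G (Fin m × Bool) H1Adj → IsStar G ⊎ IsExceptional G
  by-size zero          (φ , _) with () ← proj₁ (Inverse.to φ (fromℕ< 1≤n))
  by-size 1             iso     =
    inj₁ (1 , ≤-refl , IsoTo-trans {G} {S = starAdj} iso edge↔K₁,₁ H1Adj⇒starAdj starAdj⇒H1Adj)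
  by-size (suc (suc m)) iso     = inj₂ (inj₁ (suc (suc m) , s≤s (s≤s z≤n) , iso))

-- The excess Σ_v (deg v − 1)

1+m+1+n≡m+n+2 : ∀ m n → suc m + suc n ≡ m + n + 2
1+m+1+n≡m+n+2 = solve-∀

module Excess (G : Graph) (ni : NoIsolatedVertices G) where

  excess : Fin (n G) → ℕ
  excess v = deg G v ∸ 1

  totalExcess : ℕ
  totalExcess = ∑[ v < n G ] excess v

  deg≡1+excess : ∀ v → deg G v ≡ suc (excess v)
  deg≡1+excess v = sym (m+[n∸m]≡n (adj⇒1≤deg G (proj₂ (ni v))))

  2|E|≡n+totalExcess : 2 * |E| G ≡ n G + totalExcess
  2|E|≡n+totalExcess = begin
    2 * |E| G                    ≡⟨ sym (handshake G) ⟩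
    ∑[ v < n G ] deg G v         ≡⟨ sum-cong-≗ deg≡1+excess ⟩
    ∑[ v < n G ] (1 + excess v)  ≡⟨ ∑-distrib-+ (λ _ → 1) excess ⟩
    ∑[ v < n G ] 1 + totalExcess ≡⟨ cong (_+ totalExcess) (∑-one (n G)) ⟩
    n G + totalExcess            ∎
    where open ≡-Reasoning

  totalExcess≡0⇒1-regular : totalExcess ≡ 0 → ∀ v → deg G v ≡ 1
  totalExcess≡0⇒1-regular X≡0 v =
    trans (deg≡1+excess v) (cong suc (n≤0⇒n≡0 (subst (excess v ≤_) X≡0 (term≤∑ excess v))))

  n<2|E| : 0 < totalExcess → n G < 2 * |E| G
  n<2|E| X>0 = subst (n G <_) (sym 2|E|≡n+totalExcess)
                     (≤-trans (≤-reflexive (+-comm 1 (n G))) (+-monoʳ-≤ (n G) X>0))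

  module _ (hyp : ∀ e → e ∈ edges G → 2 * |E| G ≤ 2 * |S₁| G e + |V| G) where

    totalExcess≤-edge : ∀ {a b} → T (isEdge G a b) → totalExcess ≤ 2 * (excess a + excess b)
    totalExcess≤-edge {a} {b} ab = +-cancelˡ-≤ (n G) _ _ (begin
      n G + totalExcess               ≡⟨ sym 2|E|≡n+totalExcess ⟩
      2 * |E| G                       ≤⟨ hyp (a , b) (∈-edges⁺ G ab) ⟩
      2 * |S₁| G (a , b) + n G        ≤⟨ +-monoˡ-≤ (n G) (*-monoʳ-≤ 2 |S₁|≤) ⟩
      2 * (excess a + excess b) + n G ≡⟨ +-comm _ (n G) ⟩
      n G + 2 * (excess a + excess b) ∎)
      where
      open ≤-Reasoning
      |S₁|≤ : |S₁| G (a , b) ≤ excess a + excess b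
      |S₁|≤ = +-cancelʳ-≤ 2 _ _ (begin
        |S₁| G (a , b) + 2              ≤⟨ |S₁|+2≤deg+deg G ab ⟩
        deg G a + deg G b               ≡⟨ cong₂ _+_ (deg≡1+excess a) (deg≡1+excess b) ⟩
        suc (excess a) + suc (excess b) ≡⟨ 1+m+1+n≡m+n+2 (excess a) (excess b) ⟩
        excess a + excess b + 2         ∎)

    totalExcess≤ : ∀ {u v} → T (adj G u v) → totalExcess ≤ 2 * (excess u + excess v)
    totalExcess≤ {u} {v} uv with adj⇒isEdge G uv
    ... | inj₁ uv′ = totalExcess≤-edge uv′
    ... | inj₂ vu′ =
      subst (λ m → totalExcess ≤ 2 * m) (+-comm (excess v) (excess u)) (totalExcess≤-edge vu′)

    no-K₁,₁ : 0 < totalExcess → ¬ HasK11Component G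
    no-K₁,₁ X>0 (u , v , uv , deg-u≡1 , deg-v≡1) = <⇒≱ X>0
      (subst₂ (λ x y → totalExcess ≤ 2 * (x + y)) (cong (_∸ 1) deg-u≡1) (cong (_∸ 1) deg-v≡1)
              (totalExcess≤ uv))

    inS⇒totalExcess≤ : ∀ s → T (inS G s) → totalExcess ≤ 2 * excess s
    inS⇒totalExcess≤ s s∈S with l , sl , deg-l≡1 ← inS⇒leaf-neighbour G s∈S =
      subst (λ m → totalExcess ≤ 2 * m) (trans (cong (λ d → excess s + (d ∸ 1)) deg-l≡1) (+-identityʳ _))
        (totalExcess≤ sl)

    |S|≤2 : 0 < totalExcess → |S| G ≤ 2
    |S|≤2 X>0 = *-cancelʳ-≤ (|S| G) 2 totalExcess {{>-nonZero X>0}} (begin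
      |S| G * totalExcess
        ≡⟨ cong (_* totalExcess) (length-filterᵇ-allFin (inS G)) ⟩
      (∑[ v < n G ] 𝟙 (inS G v)) * totalExcess
        ≤⟨ count*≤∑ (inS G) (λ v → 2 * excess v) totalExcess inS⇒totalExcess≤ ⟩
      ∑[ v < n G ] (2 * excess v)
        ≡⟨ sym (*-distribˡ-sum 2 excess) ⟩
      2 * totalExcess ∎)
      where open ≤-Reasoning

lemma3p2 : (H : Graph) → 1 ≤ |V| H → Bipartite H → NoIsolatedVertices H
    → ¬ IsStar H → ¬ IsExceptional H
    → (∀ e → e ∈ edges H → 2 * |E| H ≤ 2 * |S₁| H e + |V| H)
    → (|V| H < 2 * |E| H) × ¬ HasK11Component H × |S| H ≤ 2
lemma3p2 H 1≤n _ ni ¬star ¬exceptional hyp = n<2|E| X>0 , no-K₁,₁ hyp X>0 , |S|≤2 hyp X>0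
  where
  open Excess H ni
  X>0 : 0 < totalExcess
  X>0 = n≢0⇒n>0 λ X≡0 → [ ¬star , ¬exceptional ]′
    (1-regular⇒star-or-exceptional H 1≤n ni (totalExcess≡0⇒1-regular X≡0))
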